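{- For every integer $n>2$, writing $\mathbb{Z}_n=\{0,1,\dots,n-1\}$, \[ \left|\left\{\gamma\in S_n:\ \gamma(0)=0 \text{ and } \mathbb{Z}_n\cap\{i-\gamma(i),\,i+\gamma(i)\}\neq\emptyset \text{ for all } i\in\mathbb{Z}_n\setminus\{0\}\right\}\right| = \left\lfloor \tfrac{n-1}{2}\right\rfloor!\,\cdot\,\left\lceil \tfrac{n-1}{2}\right\rceil!. \]
   Context: $S_n$ denotes the set of all permutations (bijections) of $\mathbb{Z}_n=\{0,1,\dots,n-1\}$; the expressions $i\pm\gamma(i)$ are computed in the ordinary integers. -}

module Defs where

open import Data.Nat.Base using (ℕ; _<_)
open import Data.Fin.Base using (Fin; toℕ)
open import Data.Fin.Permutation using (Permutation′; _⟨$⟩ʳ_)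
open import Data.Integer.Base using (ℤ; +_; _-_; _+_; _≤_; _<_)
open import Data.Product.Base using (Σ; _×_)
open import Data.Sum.Base using (_⊎_)
open import Relation.Binary.PropositionalEquality using (_≡_; _≢_)
open import Relation.Binary.Bundles using (Setoid)
open import Level using (0ℓ)

InZn : ℕ → ℤ → Set
InZn n x = (+ 0 ≤ x) × (x Data.Integer.Base.< + n)

Cond : (n : ℕ) → Permutation′ n → Fin n → Set
Cond n γ i = InZn n (+ toℕ i - + toℕ (γ ⟨$⟩ʳ i)) ⊎ InZn n (+ toℕ i + + toℕ (γ ⟨$⟩ʳ i))

Good : (n : ℕ) → Permutation′ n → Set
Good n γ = ((z : Fin n) → toℕ z ≡ 0 → toℕ (γ ⟨$⟩ʳ z) ≡ 0)
         × ((i : Fin n) → toℕ i ≢ 0 → Cond n γ i)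

GoodSetoid : ℕ → Setoid 0ℓ 0ℓ
GoodSetoid n = record
  { Carrier = Σ (Permutation′ n) (Good n)
  ; _≈_ = λ a b → (i : Fin n) → Σ.proj₁ a ⟨$⟩ʳ i ≡ Σ.proj₁ b ⟨$⟩ʳ i
  ; isEquivalence = record
    { refl = λ i → Relation.Binary.PropositionalEquality.refl
    ; sym = λ p i → Relation.Binary.PropositionalEquality.sym (p i)
    ; trans = λ p q i → Relation.Binary.PropositionalEquality.trans (p i) (q i)
    }
  }
  where open import Data.Product.Base using (Σ)

module Submission where

-- Write n = N + 1 and identify the nonzero points 1, …, N of ℤ_n with Fin N.
--
-- (1) A good γ fixes 0, so it is determined by the permutation σ it induces on Fin N;
--     for the point p+1 carrying the value w+1 the condition of the theorem reads
--     "w ≤ p or (p+1) + (w+1) < n"  (reduction).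
-- (2) The value w is therefore forbidden exactly on the central interval of positions
--     N-1-w ≤ p ≤ w-1, of length t w = (2w+1) ∸ N.  These intervals are nested, so
--     listing the positions from the centre outwards (the permutation zigzag) turns the
--     condition into "t (σ q) ≤ q"  (zigzag-rank, relabel, allowed⇒above).
-- (3) Staircase count: for monotone t with t v ≤ v, the permutations σ of Fin k with
--     t (σ q) ≤ q correspond to Fin (∏_{v<k} (v+1 ∸ t v)); the largest value k-1 may sit
--     at any of its k ∸ t(k-1) admissible positions, and removing it leaves an instance
--     of size k-1  (Staircase.peeling, Staircase.staircase).
-- (4) For t v = (2v+1) ∸ N the factors are 1, 2, …, ⌈N/2⌉ followed by ⌊N/2⌋, …, 1, so the
--     count is ⌊N/2⌋! ⌈N/2⌉!  (threshold-count).

open import Defs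
open import Data.Nat.Base using (ℕ; _<_; _∸_; ⌊_/2⌋; ⌈_/2⌉; _*_; _!)
open import Data.Fin.Base using (Fin)
open import Function.Bundles using (Inverse)
open import Relation.Binary.PropositionalEquality using (setoid)

open import Data.Nat.Base using (zero; suc; _+_; _≤_; z≤n; s≤s; s≤s⁻¹)
open import Data.Nat.Properties
open import Data.Nat.Tactic.RingSolver using (solve-∀)
open import Data.Fin.Base as Fin using (toℕ; fromℕ; fromℕ<; punchIn; punchOut)
import Data.Fin.Properties as Finₚ
open import Data.Fin.Permutation as Perm using (Permutation′; _⟨$⟩ʳ_; _⟨$⟩ˡ_; insert; remove; lift₀; _∘ₚ_)
import Data.Integer.Base as ℤ
import Data.Integer.Properties as ℤₚ
open import Data.Product using (Σ; _×_; _,_; proj₁)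
open import Data.Product.Relation.Binary.Pointwise.NonDependent using (_×ₛ_; Pointwise-≡↔≡)
open import Data.Product.Function.NonDependent.Setoid using (_×-inverse_)
open import Data.Sum using (_⊎_; inj₁; inj₂; map₁)
open import Data.Empty using (⊥-elim)
open import Relation.Nullary using (yes; no)
open import Relation.Binary.PropositionalEquality
open import Relation.Binary.Bundles using (Setoid)
open import Level using (0ℓ)
import Function.Construct.Composition as Composition
import Function.Construct.Identity as Identity
import Function.Construct.Symmetry as Symmetry

open Setoid using (Carrier)

infixr 5 _⨾_
_⨾_ : {A B C : Setoid 0ℓ 0ℓ} → Inverse A B → Inverse B C → Inverse A C
_⨾_ = Composition.inverse

mkInverse : (S T : Setoid 0ℓ 0ℓ) (to : Carrier S → Carrier T) (from : Carrier T → Carrier S) →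
  (∀ {x y} → Setoid._≈_ S x y → Setoid._≈_ T (to x) (to y)) →
  (∀ {x y} → Setoid._≈_ T x y → Setoid._≈_ S (from x) (from y)) →
  (∀ y → Setoid._≈_ T (to (from y)) y) → (∀ x → Setoid._≈_ S (from (to x)) x) → Inverse S T
mkInverse S T to from to-cong from-cong to∘from from∘to = record
  { to = to ; from = from ; to-cong = to-cong ; from-cong = from-cong
  ; inverse = (λ {x} e → Setoid.trans T (to-cong e) (to∘from x))
            , (λ {x} e → Setoid.trans S (from-cong e) (from∘to x)) }

Restricted : (k : ℕ) → (Fin k → Fin k → Set) → Setoid 0ℓ 0ℓ
Restricted k Q = record
  { Carrier = Σ (Permutation′ k) (λ σ → ∀ q → Q q (σ ⟨$⟩ʳ q))
  ; _≈_ = λ x y → ∀ q → proj₁ x ⟨$⟩ʳ q ≡ proj₁ y ⟨$⟩ʳ q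
  ; isEquivalence = record
    { refl = λ _ → refl ; sym = λ e q → sym (e q) ; trans = λ e f q → trans (e q) (f q) } }

relabel : ∀ {k} (Q₁ Q₂ : Fin k → Fin k → Set) (π : Permutation′ k) →
  (∀ q w → Q₁ (π ⟨$⟩ʳ q) w → Q₂ q w) → (∀ q w → Q₂ q w → Q₁ (π ⟨$⟩ʳ q) w) →
  Inverse (Restricted k Q₁) (Restricted k Q₂)
relabel {k} Q₁ Q₂ π Q₁⇒Q₂ Q₂⇒Q₁ = mkInverse (Restricted k Q₁) (Restricted k Q₂) to from
  (λ e q → e (π ⟨$⟩ʳ q)) (λ e i → e (π ⟨$⟩ˡ i))
  (λ y q → cong (proj₁ y ⟨$⟩ʳ_) (Perm.inverseˡ π))
  (λ x i → cong (proj₁ x ⟨$⟩ʳ_) (Perm.inverseʳ π))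
  where
  to : Carrier (Restricted k Q₁) → Carrier (Restricted k Q₂)
  to (γ , ok) = π ∘ₚ γ , λ q → Q₁⇒Q₂ q _ (ok (π ⟨$⟩ʳ q))
  from : Carrier (Restricted k Q₂) → Carrier (Restricted k Q₁)
  from (σ , ok) = Perm.flip π ∘ₚ σ , λ i →
    subst (λ p → Q₁ p (σ ⟨$⟩ʳ (π ⟨$⟩ˡ i))) (Perm.inverseʳ π) (Q₂⇒Q₁ (π ⟨$⟩ˡ i) _ (ok (π ⟨$⟩ˡ i)))

data PunchView {n : ℕ} (i : Fin (suc n)) : Fin (suc n) → Set where
  here : PunchView i i
  there : (p : Fin n) → PunchView i (punchIn i p)

punchView : ∀ {n} (i q : Fin (suc n)) → PunchView i q
punchView i q with i Finₚ.≟ q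
... | yes refl = here
... | no i≢q = subst (PunchView i) (Finₚ.punchIn-punchOut i≢q) (there (punchOut i≢q))

insert-here : ∀ {m n} (i : Fin (suc m)) (j : Fin (suc n)) (π : Perm.Permutation m n) → insert i j π ⟨$⟩ʳ i ≡ j
insert-here i j π with i Finₚ.≟ i
... | yes _ = refl
... | no i≢i = ⊥-elim (i≢i refl)

insert-cong : ∀ {m} {i i' j j' : Fin (suc m)} (π ρ : Permutation′ m) → i ≡ i' → j ≡ j' → π Perm.≈ ρ →
  insert i j π Perm.≈ insert i' j' ρ
insert-cong {i = i} {j = j} π ρ refl refl π≈ρ q with punchView i q
... | here = trans (insert-here i j π) (sym (insert-here i j ρ))
... | there p = begin
    insert i j π ⟨$⟩ʳ punchIn i p ≡⟨ Perm.insert-punchIn i j π p ⟩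
    punchIn j (π ⟨$⟩ʳ p)          ≡⟨ cong (punchIn j) (π≈ρ p) ⟩
    punchIn j (ρ ⟨$⟩ʳ p)          ≡⟨ Perm.insert-punchIn i j ρ p ⟨
    insert i j ρ ⟨$⟩ʳ punchIn i p ∎
  where open ≡-Reasoning

remove-cong : ∀ {m} {i i' : Fin (suc m)} (π ρ : Permutation′ (suc m)) → i ≡ i' → π Perm.≈ ρ →
  remove i π Perm.≈ remove i' ρ
remove-cong {i = i} π ρ refl π≈ρ p = Finₚ.punchIn-injective (π ⟨$⟩ʳ i) _ _ (begin
    punchIn (π ⟨$⟩ʳ i) (remove i π ⟨$⟩ʳ p) ≡⟨ Perm.punchIn-permute π i p ⟨
    π ⟨$⟩ʳ punchIn i p                     ≡⟨ π≈ρ (punchIn i p) ⟩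
    ρ ⟨$⟩ʳ punchIn i p                     ≡⟨ Perm.punchIn-permute ρ i p ⟩
    punchIn (ρ ⟨$⟩ʳ i) (remove i ρ ⟨$⟩ʳ p) ≡⟨ cong (λ k → punchIn k (remove i ρ ⟨$⟩ʳ p)) (π≈ρ i) ⟨
    punchIn (π ⟨$⟩ʳ i) (remove i ρ ⟨$⟩ʳ p) ∎)
  where open ≡-Reasoning

toℕ-punchIn : ∀ {n} (i : Fin (suc n)) (p : Fin n) →
  (toℕ (punchIn i p) ≡ toℕ p × toℕ p < toℕ i) ⊎ (toℕ i ≤ toℕ p × toℕ (punchIn i p) ≡ suc (toℕ p))
toℕ-punchIn Fin.zero p = inj₂ (z≤n , refl)
toℕ-punchIn (Fin.suc i) Fin.zero = inj₁ (refl , s≤s z≤n)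
toℕ-punchIn (Fin.suc i) (Fin.suc p) with toℕ-punchIn i p
... | inj₁ (eq , p<i) = inj₁ (cong suc eq , s≤s p<i)
... | inj₂ (i≤p , eq) = inj₂ (s≤s i≤p , cong suc eq)

punchIn-≥ : ∀ {n} (i : Fin (suc n)) (p : Fin n) → toℕ p ≤ toℕ (punchIn i p)
punchIn-≥ i p with toℕ-punchIn i p
... | inj₁ (eq , _) = ≤-reflexive (sym eq)
... | inj₂ (_ , eq) = subst (toℕ p ≤_) (sym eq) (n≤1+n _)

punchIn-last : ∀ {n} (p : Fin n) → toℕ (punchIn (fromℕ n) p) ≡ toℕ p
punchIn-last {n} p with toℕ-punchIn (fromℕ n) p
... | inj₁ (eq , _) = eq
... | inj₂ (n≤p , _) = ⊥-elim (<⇒≱ (Finₚ.toℕ<n p) (subst (_≤ toℕ p) (Finₚ.toℕ-fromℕ n) n≤p))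

Π : (ℕ → ℕ) → ℕ → ℕ
Π f zero = 1
Π f (suc k) = f k * Π f k

Π-cong : ∀ {f g} k → (∀ j → j < k → f j ≡ g j) → Π f k ≡ Π g k
Π-cong zero _ = refl
Π-cong (suc k) f≡g = cong₂ _*_ (f≡g k ≤-refl) (Π-cong k (λ j j<k → f≡g j (m<n⇒m<1+n j<k)))

Π-split : ∀ f b k → Π f (b + k) ≡ Π (λ j → f (b + j)) k * Π f b
Π-split f b zero rewrite +-identityʳ b = sym (+-identityʳ (Π f b))
Π-split f b (suc k) rewrite +-suc b k | Π-split f b k = sym (*-assoc (f (b + k)) (Π (λ j → f (b + j)) k) (Π f b))

Π-suc : ∀ k → Π suc k ≡ k !
Π-suc zero = refl
Π-suc (suc k) = cong (suc k *_) (Π-suc k)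

Π-falling : ∀ a → Π (a ∸_) a ≡ a !
Π-falling zero = refl
Π-falling (suc a) = begin
  Π (suc a ∸_) (1 + a)                   ≡⟨ Π-split (suc a ∸_) 1 a ⟩
  Π (a ∸_) a * (suc a * 1)               ≡⟨ cong₂ _*_ (Π-falling a) (*-identityʳ (suc a)) ⟩
  a ! * suc a                            ≡⟨ *-comm (a !) (suc a) ⟩
  suc a ! ∎
  where open ≡-Reasoning

module Staircase (t : ℕ → ℕ) (t-mono : ∀ {v w} → v ≤ w → t v ≤ t w) where

  Above : ∀ k → Fin k → Fin k → Set
  Above k q w = t (toℕ w) ≤ toℕ q

  -- the number of admissible positions for the value v once all larger values are placed
  factor : ℕ → ℕ
  factor v = suc v ∸ t v

  count : ℕ → ℕ
  count = Π factor

  -- Peeling off the largest value m: an admissible permutation of Fin (m+1) is the same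
  -- as an admissible position for m together with an admissible permutation of Fin m.
  module Peel (m : ℕ) (tm≤m : t m ≤ m) where
    Big = Restricted (suc m) (Above (suc m))
    Small = Restricted m (Above m)

    top : Fin (suc m)
    top = fromℕ m

    slot : Permutation′ (suc m) → Fin (suc m)
    slot σ = σ ⟨$⟩ˡ top

    slot-cong : ∀ σ ρ → σ Perm.≈ ρ → slot σ ≡ slot ρ
    slot-cong σ ρ σ≈ρ = trans (sym (Perm.inverseˡ ρ)) (cong (ρ ⟨$⟩ˡ_) (trans (sym (σ≈ρ (slot σ))) (Perm.inverseʳ σ)))

    slot-insert : ∀ i (σ : Permutation′ m) → slot (insert i top σ) ≡ i
    slot-insert i σ = trans (cong (insert i top σ ⟨$⟩ˡ_) (sym (insert-here i top σ))) (Perm.inverseˡ (insert i top σ))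

    slot-admissible : (x : Carrier Big) → t m ≤ toℕ (slot (proj₁ x))
    slot-admissible (σ , ok) =
      subst (λ v → t v ≤ toℕ (slot σ)) (trans (cong toℕ (Perm.inverseʳ σ)) (Finₚ.toℕ-fromℕ m)) (ok (slot σ))

    position : Fin (factor m) → Fin (suc m)
    position j = fromℕ< {t m + toℕ j}
      (subst (t m + toℕ j <_) (m+[n∸m]≡n (m≤n⇒m≤1+n tm≤m)) (+-monoʳ-< (t m) (Finₚ.toℕ<n j)))

    toℕ-position : ∀ j → toℕ (position j) ≡ t m + toℕ j
    toℕ-position j = Finₚ.toℕ-fromℕ< _

    offset : Carrier Big → Fin (factor m)
    offset x = fromℕ< (∸-monoˡ-< (Finₚ.toℕ<n (slot (proj₁ x))) (slot-admissible x))

    position-offset : ∀ x → position (offset x) ≡ slot (proj₁ x)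
    position-offset x = Finₚ.toℕ-injective (begin
      toℕ (position (offset x))                ≡⟨ toℕ-position (offset x) ⟩
      t m + toℕ (offset x)                     ≡⟨ cong (t m +_) (Finₚ.toℕ-fromℕ< _) ⟩
      t m + (toℕ (slot (proj₁ x)) ∸ t m)       ≡⟨ m+[n∸m]≡n (slot-admissible x) ⟩
      toℕ (slot (proj₁ x))                     ∎)
      where open ≡-Reasoning

    offset-position : ∀ x j → slot (proj₁ x) ≡ position j → offset x ≡ j
    offset-position x j slot≡ = Finₚ.toℕ-injective (begin
      toℕ (offset x)                  ≡⟨ Finₚ.toℕ-fromℕ< _ ⟩
      toℕ (slot (proj₁ x)) ∸ t m      ≡⟨ cong (λ i → toℕ i ∸ t m) slot≡ ⟩
      toℕ (position j) ∸ t m          ≡⟨ cong (_∸ t m) (toℕ-position j) ⟩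
      t m + toℕ j ∸ t m               ≡⟨ m+n∸m≡n (t m) (toℕ j) ⟩
      toℕ j                           ∎)
      where open ≡-Reasoning

    -- Removing the largest value keeps the rest admissible: positions after the slot move
    -- down by one, but they still lie beyond t m ≥ t of every remaining value.
    remaining-admissible : (x : Carrier Big) → ∀ p → Above m p (remove (slot (proj₁ x)) (proj₁ x) ⟨$⟩ʳ p)
    remaining-admissible x@(σ , ok) p with toℕ-punchIn (slot σ) p
    ... | inj₁ (eq , _) = subst (t (toℕ w) ≤_) eq bound
      where
      w = remove (slot σ) σ ⟨$⟩ʳ p
      bound : t (toℕ w) ≤ toℕ (punchIn (slot σ) p)
      bound = subst (λ v → t v ≤ toℕ (punchIn (slot σ) p))
        (trans (cong toℕ (Perm.punchIn-permute′ σ top p)) (punchIn-last w)) (ok (punchIn (slot σ) p))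
    ... | inj₂ (slot≤p , _) =
      ≤-trans (t-mono (<⇒≤ (Finₚ.toℕ<n (remove (slot σ) σ ⟨$⟩ʳ p)))) (≤-trans (slot-admissible x) slot≤p)

    inserted-admissible : ∀ j (σ : Permutation′ m) → (∀ p → Above m p (σ ⟨$⟩ʳ p)) →
      ∀ q → Above (suc m) q (insert (position j) top σ ⟨$⟩ʳ q)
    inserted-admissible j σ ok q with punchView (position j) q
    ... | here rewrite insert-here (position j) top σ | Finₚ.toℕ-fromℕ m | toℕ-position j =
      m≤m+n (t m) (toℕ j)
    ... | there p rewrite Perm.insert-punchIn (position j) top σ p | punchIn-last (σ ⟨$⟩ʳ p) =
      ≤-trans (ok p) (punchIn-≥ (position j) p)

    peel : Carrier Big → Fin (factor m) × Carrier Small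
    peel x = offset x , remove (slot (proj₁ x)) (proj₁ x) , remaining-admissible x

    unpeel : Fin (factor m) × Carrier Small → Carrier Big
    unpeel (j , σ , ok) = insert (position j) top σ , inserted-admissible j σ ok

    peeling : Inverse Big (setoid (Fin (factor m)) ×ₛ Small)
    peeling = mkInverse Big (setoid (Fin (factor m)) ×ₛ Small) peel unpeel
      (λ {x} {y} → peel-cong {x} {y}) (λ {y} {z} → unpeel-cong {y} {z}) peel-unpeel unpeel-peel
      where
      peel-cong : ∀ {x y} → Setoid._≈_ Big x y → Setoid._≈_ (setoid (Fin (factor m)) ×ₛ Small) (peel x) (peel y)
      peel-cong {x} {y} x≈y = offset-position x (offset y) (trans (slot-cong (proj₁ x) (proj₁ y) x≈y) (sym (position-offset y)))
                            , remove-cong (proj₁ x) (proj₁ y) (slot-cong (proj₁ x) (proj₁ y) x≈y) x≈y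

      unpeel-cong : ∀ {y z} → Setoid._≈_ (setoid (Fin (factor m)) ×ₛ Small) y z → Setoid._≈_ Big (unpeel y) (unpeel z)
      unpeel-cong {j , σ , _} {_ , ρ , _} (refl , σ≈ρ) = insert-cong σ ρ (refl {x = position j}) (refl {x = top}) σ≈ρ

      peel-unpeel : ∀ y → Setoid._≈_ (setoid (Fin (factor m)) ×ₛ Small) (peel (unpeel y)) y
      peel-unpeel (j , σ , ok) = offset-position (unpeel (j , σ , ok)) j (slot-insert (position j) σ)
                               , λ p → trans (remove-cong (insert (position j) top σ) (insert (position j) top σ) (slot-insert (position j) σ) (λ _ → refl) p)
                                             (Perm.remove-insert (position j) top σ p)

      unpeel-peel : ∀ x → Setoid._≈_ Big (unpeel (peel x)) x
      unpeel-peel (σ , ok) q = trans (insert-cong (remove (slot σ) σ) (remove (slot σ) σ) (position-offset (σ , ok)) (sym (Perm.inverseʳ σ)) (λ _ → refl) q)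
                                     (Perm.insert-remove (slot σ) σ q)

  staircase : ∀ k → (∀ v → v < k → t v ≤ v) → Inverse (Restricted k (Above k)) (setoid (Fin (count k)))
  staircase zero _ = mkInverse (Restricted 0 (Above 0)) (setoid (Fin 1)) (λ _ → Fin.zero) (λ _ → Perm.id , λ ())
    (λ _ → refl) (λ _ ()) (λ { Fin.zero → refl }) (λ _ ())
  staircase (suc m) t≤ =
    peeling ⨾ (Identity.inverse (setoid (Fin (factor m))) ×-inverse staircase m (λ v v<m → t≤ v (m<n⇒m<1+n v<m)))
            ⨾ Pointwise-≡↔≡ ⨾ Symmetry.inverse Finₚ.*↔×
    where open Peel m (t≤ m ≤-refl)

-- The condition of the theorem at the nonzero point i+1 of ℤ_{N+1} carrying the value
-- w+1, computed in ℕ: either (i+1) - (w+1) ≥ 0 or (i+1) + (w+1) < N+1.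
AllowedAt : ℕ → ℕ → ℕ → Set
AllowedAt N i w = w ≤ i ⊎ suc i + suc w < suc N

Allowed : (N : ℕ) → Fin N → Fin N → Set
Allowed N p w = AllowedAt N (toℕ p) (toℕ w)

Cond⇒ : ∀ M a b → InZn M (ℤ.+ a ℤ.- ℤ.+ b) ⊎ InZn M (ℤ.+ a ℤ.+ ℤ.+ b) → b ≤ a ⊎ a + b < M
Cond⇒ M a b (inj₁ (0≤a-b , _)) = inj₁ (ℤₚ.drop‿+≤+ (ℤₚ.0≤i-j⇒j≤i 0≤a-b))
Cond⇒ M a b (inj₂ (_ , ℤ.+<+ a+b<M)) = inj₂ a+b<M

Cond⇐ : ∀ M a b → a < M → b ≤ a ⊎ a + b < M → InZn M (ℤ.+ a ℤ.- ℤ.+ b) ⊎ InZn M (ℤ.+ a ℤ.+ ℤ.+ b)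
Cond⇐ M a b a<M (inj₁ b≤a) = inj₁ (ℤₚ.i≤j⇒0≤j-i (ℤ.+≤+ b≤a) , ℤₚ.≤-<-trans a-b≤a (ℤ.+<+ a<M))
  where
  a-b≤a : ℤ.+ a ℤ.- ℤ.+ b ℤ.≤ ℤ.+ a
  a-b≤a = subst (ℤ._≤ ℤ.+ a) (sym (ℤₚ.[+m]-[+n]≡m⊖n a b)) (ℤₚ.m⊖n≤m a b)
Cond⇐ M a b _ (inj₂ a+b<M) = inj₂ (ℤ.+≤+ z≤n , ℤ.+<+ a+b<M)

module Reduction (N : ℕ) where
  Good₊ = GoodSetoid (suc N)

  fixes-zero : (x : Carrier Good₊) → proj₁ x ⟨$⟩ʳ Fin.zero ≡ Fin.zero
  fixes-zero (γ , γ0≡0 , _) = Finₚ.toℕ-injective (γ0≡0 Fin.zero refl)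

  value-suc : (x : Carrier Good₊) (p : Fin N) →
    proj₁ x ⟨$⟩ʳ Fin.suc p ≡ Fin.suc (remove Fin.zero (proj₁ x) ⟨$⟩ʳ p)
  value-suc x p = trans (Perm.punchIn-permute (proj₁ x) Fin.zero p)
                        (cong (λ z → punchIn z (remove Fin.zero (proj₁ x) ⟨$⟩ʳ p)) (fixes-zero x))

  restrict : Carrier Good₊ → Carrier (Restricted N (Allowed N))
  restrict x@(γ , _ , γ-cond) = remove Fin.zero γ , λ p →
    map₁ s≤s⁻¹ (subst (λ b → b ≤ suc (toℕ p) ⊎ suc (toℕ p) + b < suc N) (cong toℕ (value-suc x p))
                       (Cond⇒ (suc N) (suc (toℕ p)) _ (γ-cond (Fin.suc p) (λ ()))))

  extend : Carrier (Restricted N (Allowed N)) → Carrier Good₊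
  extend (σ , allowed) = lift₀ σ , fixes , cond
    where
    fixes : (z : Fin (suc N)) → toℕ z ≡ 0 → toℕ (lift₀ σ ⟨$⟩ʳ z) ≡ 0
    fixes Fin.zero _ = refl
    fixes (Fin.suc z) ()
    cond : (i : Fin (suc N)) → toℕ i ≢ 0 → Cond (suc N) (lift₀ σ) i
    cond Fin.zero i≢0 = ⊥-elim (i≢0 refl)
    cond (Fin.suc p) _ = Cond⇐ (suc N) (suc (toℕ p)) (suc (toℕ (σ ⟨$⟩ʳ p))) (s≤s (Finₚ.toℕ<n p)) (map₁ s≤s (allowed p))

  reduction : Inverse Good₊ (Restricted N (Allowed N))
  reduction = mkInverse Good₊ (Restricted N (Allowed N)) restrict extend
    (λ {x} {y} x≈y → remove-cong (proj₁ x) (proj₁ y) refl x≈y)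
    (λ {x} {y} x≈y → Perm.lift₀-cong (proj₁ x) (proj₁ y) x≈y)
    (λ y p → Finₚ.suc-injective (sym (Perm.punchIn-permute (lift₀ (proj₁ y)) Fin.zero p)))
    (λ x → Perm.lift₀-remove (proj₁ x) (fixes-zero x))

-- The positions of Fin N from the centre outwards, alternating sides: zigzag (N+1) ends
-- with the new outermost position N and before it runs through the mirror image
-- i ↦ N-1-i of zigzag N.
zigzag : (N : ℕ) → Permutation′ N
zigzag zero = Perm.id
zigzag (suc N) = insert (fromℕ N) (fromℕ N) (zigzag N ∘ₚ Perm.reverse)

-- i is the position of rank q in the zigzag order of Fin N: 2i+1 is N-1-q or N+q.
ZigzagAt : ℕ → ℕ → ℕ → Set
ZigzagAt N q i = suc (i + i) + suc q ≡ N ⊎ suc (i + i) ≡ N + q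

zigzagAt-mirror : ∀ {N} q i i' → i' + suc i ≡ N → ZigzagAt N q i → ZigzagAt (suc N) q i'
zigzagAt-mirror q i i' refl (inj₁ eq) with +-cancelʳ-≡ (suc i) (suc (i + q)) i' (trans (shuffle i q) eq)
  where
  shuffle : ∀ i q → suc (i + q) + suc i ≡ suc (i + i) + suc q
  shuffle = solve-∀
... | refl = inj₂ (balance i q)
  where
  balance : ∀ i q → suc (suc (i + q) + suc (i + q)) ≡ suc (suc (i + q) + suc i) + q
  balance = solve-∀
zigzagAt-mirror q i i' refl (inj₂ eq) with +-cancelʳ-≡ (suc i) i (i' + q) (trans (+-suc i i) (trans eq (shuffle i' i q)))
  where
  shuffle : ∀ i' i q → i' + suc i + q ≡ i' + q + suc i
  shuffle = solve-∀
... | refl = inj₁ (balance i' q)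
  where
  balance : ∀ i' q → suc (i' + i') + suc q ≡ suc (i' + suc (i' + q))
  balance = solve-∀

zigzag-rank : ∀ N (q : Fin N) → ZigzagAt N (toℕ q) (toℕ (zigzag N ⟨$⟩ʳ q))
zigzag-rank (suc N) q with punchView (fromℕ N) q
... | here rewrite insert-here (fromℕ N) (fromℕ N) (zigzag N ∘ₚ Perm.reverse) | Finₚ.toℕ-fromℕ N = inj₂ refl
... | there p = subst₂ (ZigzagAt (suc N)) (sym (punchIn-last p)) (sym mirrored)
  (zigzagAt-mirror (toℕ p) i (N ∸ suc i) (m∸n+n≡m (Finₚ.toℕ<n (zigzag N ⟨$⟩ʳ p))) (zigzag-rank N p))
  where
  i = toℕ (zigzag N ⟨$⟩ʳ p)
  mirrored : toℕ (zigzag (suc N) ⟨$⟩ʳ punchIn (fromℕ N) p) ≡ N ∸ suc i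
  mirrored = begin
    toℕ (zigzag (suc N) ⟨$⟩ʳ punchIn (fromℕ N) p)
      ≡⟨ cong toℕ (Perm.insert-punchIn (fromℕ N) (fromℕ N) (zigzag N ∘ₚ Perm.reverse) p) ⟩
    toℕ (punchIn (fromℕ N) (Fin.opposite (zigzag N ⟨$⟩ʳ p))) ≡⟨ punchIn-last _ ⟩
    toℕ (Fin.opposite (zigzag N ⟨$⟩ʳ p))                      ≡⟨ Finₚ.opposite-prop _ ⟩
    N ∸ suc i                                                   ∎
    where open ≡-Reasoning

halve : ∀ {w x} → w + w ≤ suc (x + x) → w ≤ x
halve {w} {x} w+w≤ with w ≤? x
... | yes w≤x = w≤x
... | no w≰x = ⊥-elim (<⇒≱ (s≤s (+-monoʳ-< x (n<1+n x))) (≤-trans (+-mono-≤ x<w x<w) w+w≤))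
  where
  x<w = ≰⇒> w≰x

-- The value w is forbidden at the (threshold N w) positions of smallest zigzag rank.
threshold : ℕ → ℕ → ℕ
threshold N w = suc (w + w) ∸ N

threshold-mono : ∀ N {v w} → v ≤ w → threshold N v ≤ threshold N w
threshold-mono N v≤w = ∸-monoˡ-≤ N (s≤s (+-mono-≤ v≤w v≤w))

threshold≤ : ∀ N v → v < N → threshold N v ≤ v
threshold≤ N v v<N = m≤n+o⇒m∸n≤o (suc (v + v)) N (+-monoˡ-≤ v v<N)

-- At the position i of zigzag rank q, AllowedAt N i w says exactly 2w+1 ≤ N+q.  When
-- 2i+1 < N, i.e. N = (2i+1) + (q+1), both sides amount to w ≤ i + q; otherwise, i.e. when
-- 2i+1 = N + q, both sides amount to w ≤ i.
inner-shift : ∀ i q → suc (i + i) + suc q ≡ suc i + suc (i + q)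
inner-shift = solve-∀

inner-double : ∀ i q → suc (i + i) + suc q + q ≡ suc (suc ((i + q) + (i + q)))
inner-double = solve-∀

inner-allowed⇒ : ∀ i q w → AllowedAt (suc (i + i) + suc q) i w → w ≤ i + q
inner-allowed⇒ i q w (inj₁ w≤i) = m≤n⇒m≤n+o q w≤i
inner-allowed⇒ i q w (inj₂ lt) =
  s≤s⁻¹ (+-cancelˡ-≤ (suc i) (suc w) (suc (i + q)) (subst (suc i + suc w ≤_) (inner-shift i q) (s≤s⁻¹ lt)))

outer-allowed⇒ : ∀ N q i w → suc (i + i) ≡ N + q → AllowedAt N i w → w ≤ i
outer-allowed⇒ N q i w eq (inj₁ w≤i) = w≤i
outer-allowed⇒ N q i w eq (inj₂ lt) = <⇒≤ (+-cancelˡ-≤ (suc i) (suc w) i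
  (≤-trans (s≤s⁻¹ lt) (≤-trans (m≤m+n N q) (≤-reflexive (sym eq)))))

allowed⇒bounded : ∀ N q i w → ZigzagAt N q i → AllowedAt N i w → suc (w + w) ≤ N + q
allowed⇒bounded N q i w (inj₁ refl) allowed =
  subst (suc (w + w) ≤_) (sym (inner-double i q)) (s≤s (≤-trans (+-mono-≤ w≤ w≤) (n≤1+n _)))
  where
  w≤ = inner-allowed⇒ i q w allowed
allowed⇒bounded N q i w (inj₂ eq) allowed = subst (suc (w + w) ≤_) eq (s≤s (+-mono-≤ w≤i w≤i))
  where
  w≤i = outer-allowed⇒ N q i w eq allowed

bounded⇒allowed : ∀ N q i w → ZigzagAt N q i → suc (w + w) ≤ N + q → AllowedAt N i w
bounded⇒allowed N q i w (inj₁ refl) bounded =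
  inj₂ (s≤s (subst (suc i + suc w ≤_) (sym (inner-shift i q)) (+-monoʳ-≤ (suc i) (s≤s w≤))))
  where
  w≤ = halve (s≤s⁻¹ (subst (suc (w + w) ≤_) (inner-double i q) bounded))
bounded⇒allowed N q i w (inj₂ eq) bounded =
  inj₁ (halve (≤-trans (s≤s⁻¹ (subst (suc (w + w) ≤_) (sym eq) bounded)) (n≤1+n _)))

module _ (N : ℕ) where
  open Staircase (threshold N) (threshold-mono N)

  allowed⇒above : ∀ q w → Allowed N (zigzag N ⟨$⟩ʳ q) w → Above N q w
  allowed⇒above q w allowed = m≤n+o⇒m∸n≤o (suc (toℕ w + toℕ w)) N
    (allowed⇒bounded N (toℕ q) (toℕ (zigzag N ⟨$⟩ʳ q)) (toℕ w) (zigzag-rank N q) allowed)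

  above⇒allowed : ∀ q w → Above N q w → Allowed N (zigzag N ⟨$⟩ʳ q) w
  above⇒allowed q w above = bounded⇒allowed N (toℕ q) (toℕ (zigzag N ⟨$⟩ʳ q)) (toℕ w) (zigzag-rank N q)
    (≤-trans (m≤n+m∸n (suc (toℕ w + toℕ w)) N) (+-monoʳ-≤ N above))

factor-low : ∀ N v → suc (v + v) ≤ N → suc v ∸ threshold N v ≡ suc v
factor-low N v small rewrite m≤n⇒m∸n≡0 small = refl

factor-high : ∀ N v → v ≤ N → N ≤ suc (v + v) → suc v ∸ threshold N v ≡ N ∸ v
factor-high N v v≤N large = begin
  suc v ∸ (suc (v + v) ∸ N)        ≡⟨ cong (λ M → suc v ∸ (suc (v + v) ∸ M)) (sym N≡v+k) ⟩
  suc v ∸ (suc (v + v) ∸ (v + k))  ≡⟨ cong (λ M → suc v ∸ (M ∸ (v + k))) (sym (+-suc v v)) ⟩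
  suc v ∸ (v + suc v ∸ (v + k))    ≡⟨ cong (suc v ∸_) ([m+n]∸[m+o]≡n∸o v (suc v) k) ⟩
  suc v ∸ (suc v ∸ k)              ≡⟨ m∸[m∸n]≡n k≤1+v ⟩
  k                                ∎
  where
  open ≡-Reasoning
  k = N ∸ v
  N≡v+k : v + k ≡ N
  N≡v+k = m+[n∸m]≡n v≤N
  k≤1+v : k ≤ suc v
  k≤1+v = +-cancelˡ-≤ v k (suc v) (subst₂ _≤_ (sym N≡v+k) (sym (+-suc v v)) large)

staircase-product : ∀ a b → a ≤ b → b ≤ suc a → Π (λ v → suc v ∸ threshold (b + a) v) (b + a) ≡ a ! * b !
staircase-product a b a≤b b≤1+a = begin
  Π f (b + a)                   ≡⟨ Π-split f b a ⟩
  Π (λ j → f (b + j)) a * Π f b ≡⟨ cong₂ _*_ (Π-cong a high) (Π-cong b low) ⟩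
  Π (a ∸_) a * Π suc b          ≡⟨ cong₂ _*_ (Π-falling a) (Π-suc b) ⟩
  a ! * b !                     ∎
  where
  open ≡-Reasoning
  f = λ v → suc v ∸ threshold (b + a) v
  low : ∀ v → v < b → f v ≡ suc v
  low v v<b = factor-low (b + a) v (+-mono-≤ v<b (s≤s⁻¹ (≤-trans v<b b≤1+a)))
  high : ∀ j → j < a → f (b + j) ≡ a ∸ j
  high j j<a = trans (factor-high (b + a) (b + j) (+-monoʳ-≤ b (<⇒≤ j<a)) beyond) ([m+n]∸[m+o]≡n∸o b a j)
    where
    beyond : b + a ≤ suc ((b + j) + (b + j))
    beyond = ≤-trans (+-mono-≤ (m≤m+n b j) (≤-trans a≤b (m≤m+n b j))) (n≤1+n _)

⌈n/2⌉≤1+⌊n/2⌋ : ∀ n → ⌈ n /2⌉ ≤ suc ⌊ n /2⌋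
⌈n/2⌉≤1+⌊n/2⌋ zero = z≤n
⌈n/2⌉≤1+⌊n/2⌋ (suc zero) = s≤s z≤n
⌈n/2⌉≤1+⌊n/2⌋ (suc (suc n)) = s≤s (⌈n/2⌉≤1+⌊n/2⌋ n)

threshold-count : ∀ N → Π (λ v → suc v ∸ threshold N v) N ≡ ⌊ N /2⌋ ! * ⌈ N /2⌉ !
threshold-count N = subst (λ M → Π (λ v → suc v ∸ threshold M v) M ≡ ⌊ N /2⌋ ! * ⌈ N /2⌉ !) halves
  (staircase-product ⌊ N /2⌋ ⌈ N /2⌉ (⌊n/2⌋≤⌈n/2⌉ N) (⌈n/2⌉≤1+⌊n/2⌋ N))
  where
  halves : ⌈ N /2⌉ + ⌊ N /2⌋ ≡ N
  halves = trans (+-comm ⌈ N /2⌉ ⌊ N /2⌋) (⌊n/2⌋+⌈n/2⌉≡n N)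

proposition2p1 : (n : ℕ) → 2 < n →
    Inverse (GoodSetoid n) (setoid (Fin ((⌊ n ∸ 1 /2⌋ !) * (⌈ n ∸ 1 /2⌉ !))))
proposition2p1 (suc N) _ =
  subst (λ K → Inverse (GoodSetoid (suc N)) (setoid (Fin K))) (threshold-count N)
    (Reduction.reduction N
      ⨾ relabel (Allowed N) (Above N) (zigzag N) (allowed⇒above N) (above⇒allowed N)
      ⨾ staircase N (threshold≤ N))
  where open Staircase (threshold N) (threshold-mono N)
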